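{- Let $G$ be a $t$-boundaried graph with boundary $B=\{v_1,\dots,v_t\}$. Then $\mathfrak{s}^0_G$ is a $t$-representative function.
   Context: A $t$-boundaried graph is a finite simple undirected graph with an injective labeling $\lambda\colon\{1,\dots,t\}\to V$; its boundary is the set of labeled vertices. For $S\subseteq B$, $\mathfrak{s}_G(S)$ is the maximum of $|X|$ over independent sets $X$ of $G$ with $X\cap B\subseteq S$, and $\mathfrak{s}^0_G(S)=\mathfrak{s}_G(S)-\mathfrak{s}_G(\emptyset)$. A function $f\colon 2^B\to\mathbb{N}$ (where $\mathbb{N}$ includes $0$) is a $t$-representative function if (1) $f(\emptyset)=0$; (2) $f(S')\le f(S)$ whenever $S'\subseteq S\subseteq B$; (3) for every nonempty $S\subseteq B$, $f(S)\le 1+\min_{v\in S}f(S\setminus\{v\})$. -}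

module Defs where

open import Data.Bool using (Bool; true; false; _∧_; if_then_else_)
open import Data.Nat using (ℕ; zero; suc; _≤_; _∸_; _+_; _⊔_)
open import Data.Fin using (Fin)
open import Data.Fin.Subset using (Subset; ⊥; _∈_; _⊆_; _-_; ∣_∣; Nonempty)
open import Data.Vec using (Vec; []; _∷_; lookup)
open import Data.List using (List; []; _∷_; map; _++_; foldr; allFin)
open import Function.Definitions using (Injective)
open import Relation.Binary.PropositionalEquality using (_≡_)

record Graph (n : ℕ) : Set where
  field
    adj   : Fin n → Fin n → Bool
    sym   : ∀ u v → adj u v ≡ adj v u
    irrefl : ∀ u → adj u u ≡ false

-- The boundary B is the image of the labeling; subsets of B
-- are represented (via the injective λ) as subsets of the label set Fin t.
record BoundariedGraph (t : ℕ) : Set where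
  field
    n     : ℕ
    graph : Graph n
    label : Fin t → Fin n
    label-inj : Injective _≡_ _≡_ label
  open Graph graph public

allSubsets : (n : ℕ) → List (Subset n)
allSubsets zero = [] ∷ []
allSubsets (suc n) = map (true ∷_) (allSubsets n) ++ map (false ∷_) (allSubsets n)

allB : {n : ℕ} → (Fin n → Bool) → Bool
allB {n} p = foldr (λ i b → p i ∧ b) true (allFin n)

implies : Bool → Bool → Bool
implies a b = if a then b else true

module _ {t : ℕ} (G : BoundariedGraph t) where
  open BoundariedGraph G

  independent : Subset n → Bool
  independent X = allB (λ u → allB (λ v →
    implies (lookup X u ∧ lookup X v) (if adj u v then false else true)))

  boundedBy : Subset t → Subset n → Bool
  boundedBy S X = allB (λ i → implies (lookup X (label i)) (lookup S i))

  admissible : Subset t → Subset n → Bool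
  admissible S X = independent X ∧ boundedBy S X

  -- 𝔰_G(S) = max |X| over independent X with X ∩ B ⊆ S
  -- (the maximum is over a nonempty family since X = ∅ qualifies)
  𝔰 : Subset t → ℕ
  𝔰 S = foldr (λ X m → if admissible S X then ∣ X ∣ ⊔ m else m) 0 (allSubsets n)

  -- 𝔰⁰_G(S) = 𝔰_G(S) − 𝔰_G(∅)   (truncated subtraction; 𝔰 is monotone so this is exact)
  𝔰⁰ : Subset t → ℕ
  𝔰⁰ S = 𝔰 S ∸ 𝔰 ⊥

record IsRepresentative (t : ℕ) (f : Subset t → ℕ) : Set where
  field
    empty-zero : f ⊥ ≡ 0
    monotone   : ∀ S′ S → S′ ⊆ S → f S′ ≤ f S
    -- f(S) ≤ 1 + min_{v∈S} f(S∖{v}), written pointwise over v ∈ S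
    step       : ∀ S → Nonempty S → ∀ v → v ∈ S → f S ≤ 1 + f (S - v)

-- A witness X for 𝔰(S) stays admissible when S grows, and removing the
-- boundary vertex v from X turns it into a witness for S ∖ {v} that is at most
-- one vertex smaller. Hence 𝔰 is monotone and satisfies 𝔰(S) ≤ 1 + 𝔰(S ∖ {v});
-- both properties survive subtracting the constant 𝔰(∅), which is at most
-- every 𝔰(S).
module Submission where

open import Defs
open import Data.Nat using (ℕ; _≤_; _∸_; _+_; _⊔_; z≤n; s≤s)
open import Data.Nat.Properties
  using (≤-refl; ≤-reflexive; m≤n⇒m≤1+n; ≤-trans; ⊔-lub; m≤m⊔n; m≤n⊔m; n∸n≡0; ∸-monoˡ-≤; +-monoʳ-≤; +-∸-assoc; module ≤-Reasoning)
open import Data.Bool using (Bool; true; false; _∧_; if_then_else_)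
open import Data.Fin using (Fin; zero; suc)
open import Data.Fin.Subset using (Subset; _-_; _∈_; _∉_; _⊆_; ∣_∣; outside; inside) renaming (⊥ to ∅)
open import Data.Fin.Subset.Properties using (p─⊥≡p; p─q⊆p; x∈p∧x≢y⇒x∈p-y; ⊥⊆; ⊆-refl)
open import Data.Vec as Vec using (_∷_; lookup; there)
open import Data.Vec.Properties using ([]=⇒lookup; lookup⇒[]=)
open import Data.List using (List; []; _∷_; map; foldr; allFin)
import Data.List.Membership.Propositional as List
open import Data.List.Membership.Propositional.Properties using (∈-map⁺; ∈-++⁺ˡ; ∈-++⁺ʳ)
import Data.List.Relation.Unary.Any as Any
open import Function using (_∘_)
open import Data.Product using (Σ-syntax; _×_; _,_)
open import Relation.Binary.PropositionalEquality using (_≡_; refl; sym; cong)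

∧-mono : ∀ {a b c d} → (a ≡ true → c ≡ true) → (b ≡ true → d ≡ true) →
         a ∧ b ≡ true → c ∧ d ≡ true
∧-mono {true} f g b≡true rewrite f refl = g b≡true

implies-mono : ∀ {a b a′ b′} → (a′ ≡ true → a ≡ true) → (a′ ≡ true → b ≡ true → b′ ≡ true) →
               implies a b ≡ true → implies a′ b′ ≡ true
implies-mono {a′ = false} f g _ = refl
implies-mono {a′ = true}  f g e with refl ← f refl = g refl e

allB-mono : ∀ {n} {p q : Fin n → Bool} → (∀ i → p i ≡ true → q i ≡ true) →
            allB p ≡ true → allB q ≡ true
allB-mono {n} {p} {q} p⇒q = go (allFin n)
  where
  go : ∀ is → foldr (λ i b → p i ∧ b) true is ≡ true → foldr (λ i b → q i ∧ b) true is ≡ true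
  go []       _ = refl
  go (i ∷ is) e = ∧-mono (p⇒q i) (go is) e

lookup-⊆ : ∀ {n} {X Y : Subset n} → Y ⊆ X → ∀ u → lookup Y u ≡ true → lookup X u ≡ true
lookup-⊆ {Y = Y} Y⊆X u e = []=⇒lookup (Y⊆X (lookup⇒[]= u Y e))

x∉p-x : ∀ {n} (p : Subset n) x → x ∉ p - x
x∉p-x (_ ∷ p) zero    ()
x∉p-x (_ ∷ p) (suc x) (there x∈p-x) = x∉p-x p x x∈p-x

∣p∣≤1+∣p-x∣ : ∀ {n} (p : Subset n) x → ∣ p ∣ ≤ 1 + ∣ p - x ∣
∣p∣≤1+∣p-x∣ (inside  ∷ p) zero    = s≤s (≤-reflexive (cong ∣_∣ (sym (p─⊥≡p p))))
∣p∣≤1+∣p-x∣ (outside ∷ p) zero    = m≤n⇒m≤1+n (≤-reflexive (cong ∣_∣ (sym (p─⊥≡p p))))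
∣p∣≤1+∣p-x∣ (inside  ∷ p) (suc x) = s≤s (∣p∣≤1+∣p-x∣ p x)
∣p∣≤1+∣p-x∣ (outside ∷ p) (suc x) = ∣p∣≤1+∣p-x∣ p x

-- 𝔰 G S is definitionally maxSize (admissible G S) (allSubsets n).
maxSize : ∀ {n} → (Subset n → Bool) → List (Subset n) → ℕ
maxSize p = foldr (λ X m → if p X then ∣ X ∣ ⊔ m else m) 0

maxSize-lub : ∀ {n} (p : Subset n → Bool) Xs {m} →
              (∀ {X} → X List.∈ Xs → p X ≡ true → ∣ X ∣ ≤ m) → maxSize p Xs ≤ m
maxSize-lub p []       bound = z≤n
maxSize-lub p (X ∷ Xs) bound with p X in pX
... | true  = ⊔-lub (bound (Any.here refl) pX) (maxSize-lub p Xs (bound ∘ Any.there))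
... | false = maxSize-lub p Xs (bound ∘ Any.there)

≤-maxSize : ∀ {n} (p : Subset n → Bool) {Xs X} → X List.∈ Xs → p X ≡ true → ∣ X ∣ ≤ maxSize p Xs
≤-maxSize p {Y ∷ Xs} (Any.here refl) pX rewrite pX = m≤m⊔n _ _
≤-maxSize p {Y ∷ Xs} (Any.there X∈Xs) pX with p Y
... | true  = ≤-trans (≤-maxSize p X∈Xs pX) (m≤n⊔m ∣ Y ∣ _)
... | false = ≤-maxSize p X∈Xs pX

∈-allSubsets : ∀ {n} (X : Subset n) → X List.∈ allSubsets n
∈-allSubsets Vec.[]        = Any.here refl
∈-allSubsets (inside  ∷ X) = ∈-++⁺ˡ (∈-map⁺ (inside ∷_) (∈-allSubsets X))
∈-allSubsets (outside ∷ X) = ∈-++⁺ʳ (map (inside ∷_) (allSubsets _)) (∈-map⁺ (outside ∷_) (∈-allSubsets X))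

maxSize≤k+maxSize : ∀ {n} k (p q : Subset n → Bool) →
  (∀ {X} → p X ≡ true → Σ[ Y ∈ Subset n ] q Y ≡ true × ∣ X ∣ ≤ k + ∣ Y ∣) →
  maxSize p (allSubsets n) ≤ k + maxSize q (allSubsets n)
maxSize≤k+maxSize {n} k p q shrink = maxSize-lub p (allSubsets n) λ {X} _ pX →
  let (Y , qY , ∣X∣≤k+∣Y∣) = shrink pX
  in ≤-trans ∣X∣≤k+∣Y∣ (+-monoʳ-≤ k (≤-maxSize q (∈-allSubsets Y) qY))

module _ {t : ℕ} (G : BoundariedGraph t) where
  open BoundariedGraph G

  independent-⊆ : ∀ {X Y} → Y ⊆ X → independent G X ≡ true → independent G Y ≡ true
  independent-⊆ Y⊆X = allB-mono λ u → allB-mono λ v →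
    implies-mono (∧-mono (lookup-⊆ Y⊆X u) (lookup-⊆ Y⊆X v)) λ _ nonadjacent → nonadjacent

  boundedBy-transfer : ∀ {S S′ X Y} → Y ⊆ X → (∀ {i} → label i ∈ Y → i ∈ S → i ∈ S′) →
                       boundedBy G S X ≡ true → boundedBy G S′ Y ≡ true
  boundedBy-transfer {S} {Y = Y} Y⊆X relabel = allB-mono λ i →
    implies-mono (lookup-⊆ Y⊆X (label i)) λ Yi Si →
      []=⇒lookup (relabel (lookup⇒[]= (label i) Y Yi) (lookup⇒[]= i S Si))

  admissible-transfer : ∀ {S X} S′ Y → Y ⊆ X → (∀ {i} → label i ∈ Y → i ∈ S → i ∈ S′) →
                        admissible G S X ≡ true → admissible G S′ Y ≡ true
  admissible-transfer S′ Y Y⊆X relabel =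
    ∧-mono (independent-⊆ Y⊆X) (boundedBy-transfer {S′ = S′} Y⊆X relabel)

  𝔰-mono : ∀ S′ S → S′ ⊆ S → 𝔰 G S′ ≤ 𝔰 G S
  𝔰-mono S′ S S′⊆S = maxSize≤k+maxSize 0 (admissible G S′) (admissible G S) λ {X} adm →
    X , admissible-transfer S X ⊆-refl (λ _ → S′⊆S) adm , ≤-refl

  𝔰≤1+𝔰-remove : ∀ S v → 𝔰 G S ≤ 1 + 𝔰 G (S - v)
  𝔰≤1+𝔰-remove S v = maxSize≤k+maxSize 1 (admissible G S) (admissible G (S - v)) λ {X} adm →
    X - label v ,
    admissible-transfer (S - v) (X - label v) (p─q⊆p X _) relabel adm ,
    ∣p∣≤1+∣p-x∣ X (label v)
    where
    relabel : ∀ {X i} → label i ∈ X - label v → i ∈ S → i ∈ S - v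
    relabel {X} li∈X-lv i∈S = x∈p∧x≢y⇒x∈p-y i∈S λ { refl → x∉p-x X (label v) li∈X-lv }

  𝔰⁰≤1+𝔰⁰-remove : ∀ S v → 𝔰⁰ G S ≤ 1 + 𝔰⁰ G (S - v)
  𝔰⁰≤1+𝔰⁰-remove S v = begin
    𝔰 G S ∸ 𝔰 G ∅             ≤⟨ ∸-monoˡ-≤ (𝔰 G ∅) (𝔰≤1+𝔰-remove S v) ⟩
    (1 + 𝔰 G (S - v)) ∸ 𝔰 G ∅ ≡⟨ +-∸-assoc 1 (𝔰-mono ∅ (S - v) ⊥⊆) ⟩
    1 + (𝔰 G (S - v) ∸ 𝔰 G ∅) ∎
    where open ≤-Reasoning

lemma11 : (t : ℕ) → (G : BoundariedGraph t) → IsRepresentative t (𝔰⁰ G)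
lemma11 t G = record
  { empty-zero = n∸n≡0 (𝔰 G ∅)
  ; monotone   = λ S′ S S′⊆S → ∸-monoˡ-≤ (𝔰 G ∅) (𝔰-mono G S′ S S′⊆S)
  ; step       = λ S _ v _ → 𝔰⁰≤1+𝔰⁰-remove G S v
  }
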